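{- Let $n\ge 1$ and let $\mathcal F$ be a collection of even-sized subsets of $[n]$ such that for every integer $r$ with $0\leq r\leq\lfloor n/2\rfloor$, the members of $\mathcal F$ of size $2r$ form the collection of bases of a sparse paving matroid with ground set $[n]$ and rank $2r$. Then $\mathcal F$ is the collection of feasible sets of a delta-matroid with ground set $[n]$.
   Context: $[n]=\{1,\dots,n\}$. A matroid is paving if it has no circuits of size strictly smaller than its rank, and sparse paving if both it and its dual are paving. A delta-matroid $(E,\mathcal F)$ consists of a finite set $E$ and a non-empty collection $\mathcal F$ of subsets of $E$ satisfying: for all $X,Y\in\mathcal F$ and every $e\in X\bigtriangleup Y$ there exists $f\in X\bigtriangleup Y$ (possibly $f=e$) with $X\bigtriangleup\{e,f\}\in\mathcal F$. -}

module Defs where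

open import Data.Bool using (Bool; true; false; _∧_; _xor_)
open import Data.Nat using (ℕ; _≤_; _∸_; _*_; _≡ᵇ_)
open import Data.Fin using (Fin)
open import Data.Fin.Subset using (Subset; _∈_; _∉_; _⊆_; _⊂_; _∪_; ∁; ⁅_⁆; ∣_∣; _-_)
open import Data.Vec using (zipWith)
open import Data.Product using (Σ; ∃; ∃-syntax; _×_)
open import Relation.Binary.PropositionalEquality using (_≡_)
open import Relation.Nullary using (¬_)

Family : ℕ → Set
Family n = Subset n → Bool

_∈F_ : ∀ {n} → Subset n → Family n → Set
X ∈F 𝓕 = 𝓕 X ≡ true

_△_ : ∀ {n} → Subset n → Subset n → Subset n
X △ Y = zipWith _xor_ X Y

IsMatroidBases : ∀ {n} → Family n → Set
IsMatroidBases {n} 𝓑 =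
  (∃[ B ] B ∈F 𝓑) ×
  (∀ B₁ B₂ → B₁ ∈F 𝓑 → B₂ ∈F 𝓑 → ∀ x → x ∈ B₁ → x ∉ B₂ →
     ∃[ y ] (y ∈ B₂ × y ∉ B₁ × ((B₁ - x) ∪ ⁅ y ⁆) ∈F 𝓑))

HasRank : ∀ {n} → Family n → ℕ → Set
HasRank 𝓑 k = ∀ B → B ∈F 𝓑 → ∣ B ∣ ≡ k

Independent : ∀ {n} → Family n → Subset n → Set
Independent 𝓑 I = ∃[ B ] (B ∈F 𝓑 × I ⊆ B)

Dependent : ∀ {n} → Family n → Subset n → Set
Dependent 𝓑 D = ¬ Independent 𝓑 D

Circuit : ∀ {n} → Family n → Subset n → Set
Circuit 𝓑 C = Dependent 𝓑 C × (∀ D → D ⊂ C → Independent 𝓑 D)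

IsPaving : ∀ {n} → Family n → ℕ → Set
IsPaving 𝓑 k = ∀ C → Circuit 𝓑 C → k ≤ ∣ C ∣

dualBases : ∀ {n} → Family n → Family n
dualBases 𝓑 X = 𝓑 (∁ X)

IsSparsePavingBases : (n : ℕ) → Family n → ℕ → Set
IsSparsePavingBases n 𝓑 k =
  IsMatroidBases 𝓑 × HasRank 𝓑 k ×
  IsPaving 𝓑 k × IsPaving (dualBases 𝓑) (n ∸ k)

layer : ∀ {n} → Family n → ℕ → Family n
layer 𝓕 m X = 𝓕 X ∧ (∣ X ∣ ≡ᵇ m)

IsDeltaMatroid : ∀ {n} → Family n → Set
IsDeltaMatroid {n} 𝓕 =
  (∃[ X ] X ∈F 𝓕) ×
  (∀ X Y → X ∈F 𝓕 → Y ∈F 𝓕 → ∀ e → e ∈ (X △ Y) →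
     ∃[ f ] (f ∈ (X △ Y) × (X △ (⁅ e ⁆ ∪ ⁅ f ⁆)) ∈F 𝓕))

-- Put Z = X △ {e}. Since all feasible sets are even, Z has odd size, hence is either
-- strictly smaller or strictly larger than Y. If smaller, Z is one element short of the
-- layer of rank |Z| + 1: unless Y = Z + f₁, there are distinct f₁, f₂ ∈ Y ∖ Z, and one of
-- Z + f₁, Z + f₂ is feasible. If larger, then unless Y = Z − f₁ there are distinct f₁, f₂
-- ∈ Z ∖ Y, and for S = Z − f₁ − f₂ one of S + f₁ = Z − f₂, S + f₂ = Z − f₁ is feasible.
-- Both rest on one property of a sparse paving matroid of rank k: for a (k − 1)-set S and
-- distinct a, b ∉ S, one of S + a, S + b is a basis. Indeed S is independent (paving), say
-- S + x is a basis, and S + a + b contains a basis B₂ (the dual is paving). If x ∈ B₂ then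
-- x ∈ {a, b}; otherwise basis exchange from S + x towards B₂ yields a basis S + y with y ∈
-- {a, b}.
module Submission where

open import Defs
open import Data.Bool using (true)
import Data.Bool as Bool
open import Data.Bool.Properties using (∨-identityʳ; xor-assoc; xor-comm; xor-identityʳ)
open import Data.Empty using (⊥-elim)
open import Data.Fin using (Fin; zero; suc)
open import Data.Fin.Properties using (any?)
open import Data.Fin.Subset using (Subset; ∁; _∈_; _∉_; _⊆_; _⊈_; _∪_; _─_; ⁅_⁆; ∣_∣; _-_; ⊥; inside; outside)
open import Data.Fin.Subset.Properties
open import Data.Nat using (ℕ; suc; _≤_; _<_; _*_; _∸_; _/_; s≤s; z≤n)
open import Data.Nat.DivMod using (m*n/n≡m; /-monoˡ-≤)
open import Data.Nat.Properties
  using (*-comm; *-suc; suc-injective; <-cmp; even≢odd; n<1+n; ≤-pred; ≤-trans; ≤-reflexive; <⇒≱; ∸-monoʳ-<)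
open import Data.Product using (∃-syntax; _×_; _,_; proj₁)
open import Data.Sum using (_⊎_; inj₁; inj₂; [_,_]′)
import Data.Sum as Sum
open import Data.Vec using (_∷_; here; there)
open import Data.Vec.Properties using (zipWith-assoc; zipWith-comm; zipWith-identityʳ)
open import Function using (_∘_)
open import Relation.Binary using (tri<; tri≈; tri>)
open import Relation.Binary.PropositionalEquality
open import Relation.Nullary using (Dec; yes; no; contradiction)
open import Relation.Nullary.Decidable using (_×-dec_; ¬?; decidable-stable)

private variable
  n : ℕ
  x y : Fin n
  p q : Subset n

△-assoc : (p q r : Subset n) → (p △ q) △ r ≡ p △ (q △ r)
△-assoc = zipWith-assoc xor-assoc

△-comm : (p q : Subset n) → p △ q ≡ q △ p
△-comm = zipWith-comm xor-comm

p△⊥≡p : (p : Subset n) → p △ ⊥ ≡ p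
p△⊥≡p = zipWith-identityʳ xor-identityʳ

x∉p⇒p△⁅x⁆≡p∪⁅x⁆ : x ∉ p → p △ ⁅ x ⁆ ≡ p ∪ ⁅ x ⁆
x∉p⇒p△⁅x⁆≡p∪⁅x⁆ {x = zero}  {inside ∷ p}  x∉p = contradiction here x∉p
x∉p⇒p△⁅x⁆≡p∪⁅x⁆ {x = zero}  {outside ∷ p} _   = cong (inside ∷_) (trans (p△⊥≡p p) (sym (∪-identityʳ p)))
x∉p⇒p△⁅x⁆≡p∪⁅x⁆ {x = suc x} {inside ∷ p}  x∉p = cong (inside ∷_) (x∉p⇒p△⁅x⁆≡p∪⁅x⁆ (x∉p ∘ there))
x∉p⇒p△⁅x⁆≡p∪⁅x⁆ {x = suc x} {outside ∷ p} x∉p = cong (outside ∷_) (x∉p⇒p△⁅x⁆≡p∪⁅x⁆ (x∉p ∘ there))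

x∈p⇒p△⁅x⁆≡p-x : x ∈ p → p △ ⁅ x ⁆ ≡ p - x
x∈p⇒p△⁅x⁆≡p-x {p = inside ∷ p} here = cong (outside ∷_) (trans (p△⊥≡p p) (sym (p─⊥≡p p)))
x∈p⇒p△⁅x⁆≡p-x {p = s ∷ p} (there x∈p) = cong₂ _∷_ (xor-identityʳ s) (x∈p⇒p△⁅x⁆≡p-x x∈p)

x∈p∖q⇒x∈p△q : x ∈ p → x ∉ q → x ∈ p △ q
x∈p∖q⇒x∈p△q {q = inside ∷ q}  here        x∉q = contradiction here x∉q
x∈p∖q⇒x∈p△q {q = outside ∷ q} here        _   = here
x∈p∖q⇒x∈p△q {q = _ ∷ q}       (there x∈p) x∉q = there (x∈p∖q⇒x∈p△q x∈p (x∉q ∘ there))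

x∈q∖p⇒x∈p△q : x ∈ q → x ∉ p → x ∈ p △ q
x∈q∖p⇒x∈p△q {q = q} {p = p} x∈q x∉p = subst (_ ∈_) (△-comm q p) (x∈p∖q⇒x∈p△q x∈q x∉p)

x∈p△q⇒[p△⁅x⁆]△q≡[p△q]-x : ∀ (p q : Subset n) → x ∈ p △ q → (p △ ⁅ x ⁆) △ q ≡ (p △ q) - x
x∈p△q⇒[p△⁅x⁆]△q≡[p△q]-x {x = x} p q x∈p△q = begin
  (p △ ⁅ x ⁆) △ q  ≡⟨ △-assoc p ⁅ x ⁆ q ⟩
  p △ (⁅ x ⁆ △ q)  ≡⟨ cong (p △_) (△-comm ⁅ x ⁆ q) ⟩
  p △ (q △ ⁅ x ⁆)  ≡⟨ △-assoc p q ⁅ x ⁆ ⟨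
  (p △ q) △ ⁅ x ⁆  ≡⟨ x∈p⇒p△⁅x⁆≡p-x x∈p△q ⟩
  (p △ q) - x      ∎
  where open ≡-Reasoning

x≢y⇒[p△⁅x⁆]△⁅y⁆≡p△[⁅x⁆∪⁅y⁆] : ∀ (p : Subset n) → x ≢ y → (p △ ⁅ x ⁆) △ ⁅ y ⁆ ≡ p △ (⁅ x ⁆ ∪ ⁅ y ⁆)
x≢y⇒[p△⁅x⁆]△⁅y⁆≡p△[⁅x⁆∪⁅y⁆] {x = x} {y} p x≢y =
  trans (△-assoc p ⁅ x ⁆ ⁅ y ⁆) (cong (p △_) (x∉p⇒p△⁅x⁆≡p∪⁅x⁆ (x≢y⇒x∉⁅y⁆ (x≢y ∘ sym))))

x∈p⇒p-x∪⁅x⁆≡p : x ∈ p → (p - x) ∪ ⁅ x ⁆ ≡ p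
x∈p⇒p-x∪⁅x⁆≡p {p = inside ∷ p} here = cong (inside ∷_) (trans (∪-identityʳ (p ─ ⊥)) (p─⊥≡p p))
x∈p⇒p-x∪⁅x⁆≡p {p = s ∷ p} (there x∈p) = cong₂ _∷_ (∨-identityʳ s) (x∈p⇒p-x∪⁅x⁆≡p x∈p)

x∈p-y⇒x≢y : x ∈ p - y → x ≢ y
x∈p-y⇒x≢y {x = zero} {p = _ ∷ p} {zero} () refl
x∈p-y⇒x≢y {x = suc x} {p = _ ∷ p} {suc y} (there x∈p-y) refl = x∈p-y⇒x≢y x∈p-y refl

x∉p⇒∣p∪⁅x⁆∣≡1+∣p∣ : x ∉ p → ∣ p ∪ ⁅ x ⁆ ∣ ≡ suc ∣ p ∣
x∉p⇒∣p∪⁅x⁆∣≡1+∣p∣ {x = zero}  {inside ∷ p}  x∉p = contradiction here x∉p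
x∉p⇒∣p∪⁅x⁆∣≡1+∣p∣ {x = zero}  {outside ∷ p} _   = cong (suc ∘ ∣_∣) (∪-identityʳ p)
x∉p⇒∣p∪⁅x⁆∣≡1+∣p∣ {x = suc x} {inside ∷ p}  x∉p = cong suc (x∉p⇒∣p∪⁅x⁆∣≡1+∣p∣ (x∉p ∘ there))
x∉p⇒∣p∪⁅x⁆∣≡1+∣p∣ {x = suc x} {outside ∷ p} x∉p = x∉p⇒∣p∪⁅x⁆∣≡1+∣p∣ (x∉p ∘ there)

x∈p⇒1+∣p-x∣≡∣p∣ : x ∈ p → suc ∣ p - x ∣ ≡ ∣ p ∣
x∈p⇒1+∣p-x∣≡∣p∣ {p = inside ∷ p} here = cong (suc ∘ ∣_∣) (p─⊥≡p p)
x∈p⇒1+∣p-x∣≡∣p∣ {p = inside ∷ p} (there x∈p) = cong suc (x∈p⇒1+∣p-x∣≡∣p∣ x∈p)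
x∈p⇒1+∣p-x∣≡∣p∣ {p = outside ∷ p} (there x∈p) = x∈p⇒1+∣p-x∣≡∣p∣ x∈p

p⊈q⇒∃x∈p∖q : p ⊈ q → ∃[ x ] (x ∈ p × x ∉ q)
p⊈q⇒∃x∈p∖q {p = p} {q} p⊈q with any? (λ x → x ∈? p ×-dec ¬? (x ∈? q))
... | yes found = found
... | no none = ⊥-elim (p⊈q p⊆q)
  where
  p⊆q : p ⊆ q
  p⊆q {x} x∈p = decidable-stable (x ∈? q) (λ x∉q → none (x , x∈p , x∉q))

∣q∣<∣p∣⇒∃x∈p∖q : ∣ q ∣ < ∣ p ∣ → ∃[ x ] (x ∈ p × x ∉ q)
∣q∣<∣p∣⇒∃x∈p∖q ∣q∣<∣p∣ = p⊈q⇒∃x∈p∖q (λ p⊆q → <⇒≱ ∣q∣<∣p∣ (p⊆q⇒∣p∣≤∣q∣ p⊆q))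

p⊆q∧∣q∣≤∣p∣⇒p≡q : p ⊆ q → ∣ q ∣ ≤ ∣ p ∣ → p ≡ q
p⊆q∧∣q∣≤∣p∣⇒p≡q {p = p} {q} p⊆q ∣q∣≤∣p∣ = ⊆-antisym p⊆q q⊆p
  where
  q⊆p : q ⊆ p
  q⊆p {x} x∈q = decidable-stable (x ∈? p) (λ x∉p → <⇒≱ (p⊂q⇒∣p∣<∣q∣ (p⊆q , x , x∈q , x∉p)) ∣q∣≤∣p∣)

x∉p∪⁅y⁆⁻ : x ∉ p ∪ ⁅ y ⁆ → x ∉ p × x ≢ y
x∉p∪⁅y⁆⁻ {p = p} x∉p∪⁅y⁆ = x∉p∪⁅y⁆ ∘ p⊆p∪q _ , λ { refl → x∉p∪⁅y⁆ (q⊆p∪q p _ (x∈⁅x⁆ _)) }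

∪-lub : ∀ {r : Subset n} → p ⊆ r → q ⊆ r → p ∪ q ⊆ r
∪-lub {p = p} {q} p⊆r q⊆r x∈p∪q = [ p⊆r , q⊆r ]′ (x∈p∪q⁻ p q x∈p∪q)

x∈p⇒⁅x⁆⊆p : x ∈ p → ⁅ x ⁆ ⊆ p
x∈p⇒⁅x⁆⊆p {x = x} {p} x∈p y∈⁅x⁆ = subst (_∈ p) (sym (x∈⁅y⁆⇒x≡y x y∈⁅x⁆)) x∈p

x∈p∪⁅y⁆⁻ : x ∈ p ∪ ⁅ y ⁆ → x ∈ p ⊎ x ≡ y
x∈p∪⁅y⁆⁻ {p = p} {y} x∈p∪⁅y⁆ with x∈p∪q⁻ p ⁅ y ⁆ x∈p∪⁅y⁆
... | inj₁ x∈p = inj₁ x∈p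
... | inj₂ x∈⁅y⁆ = inj₂ (x∈⁅y⁆⇒x≡y y x∈⁅y⁆)

independent? : (𝓑 : Family n) (I : Subset n) → Dec (Independent 𝓑 I)
independent? 𝓑 I = anySubset? (λ B → (𝓑 B Bool.≟ true) ×-dec (I ⊆? B))

Dependent⇒⊇Circuit : {𝓑 : Family n} (D : Subset n) → Dependent 𝓑 D → ∃[ C ] (C ⊆ D × Circuit 𝓑 C)
Dependent⇒⊇Circuit {𝓑 = 𝓑} D = go (suc ∣ D ∣) D (n<1+n ∣ D ∣)
  where
  go : ∀ m D → ∣ D ∣ < m → Dependent 𝓑 D → ∃[ C ] (C ⊆ D × Circuit 𝓑 C)
  go (suc m) D (s≤s ∣D∣≤m) D-dep with anySubset? (λ D′ → D′ ⊂? D ×-dec ¬? (independent? 𝓑 D′))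
  ... | yes (D′ , D′⊂D , D′-dep) =
    let C , C⊆D′ , C-circuit = go m D′ (≤-trans (p⊂q⇒∣p∣<∣q∣ D′⊂D) ∣D∣≤m) D′-dep
    in  C , ⊆-trans C⊆D′ (p⊂q⇒p⊆q D′⊂D) , C-circuit
  ... | no ∄D′ = D , ⊆-refl , D-dep ,
    λ D′ D′⊂D → decidable-stable (independent? 𝓑 D′) (λ D′-dep → ∄D′ (D′ , D′⊂D , D′-dep))

IsPaving⇒Independent : ∀ {𝓑 : Family n} {k I} → IsPaving 𝓑 k → ∣ I ∣ < k → Independent 𝓑 I
IsPaving⇒Independent {𝓑 = 𝓑} {I = I} paving ∣I∣<k = decidable-stable (independent? 𝓑 I) λ I-dep →
  let C , C⊆I , C-circuit = Dependent⇒⊇Circuit I I-dep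
  in  <⇒≱ ∣I∣<k (≤-trans (paving C C-circuit) (p⊆q⇒∣p∣≤∣q∣ C⊆I))

HasRank⇒⊆-basis : ∀ {𝓑 : Family n} {k A B} → HasRank 𝓑 k → B ∈F 𝓑 → A ⊆ B → ∣ A ∣ ≡ k → A ∈F 𝓑
HasRank⇒⊆-basis {𝓑 = 𝓑} rank B∈𝓑 A⊆B ∣A∣≡k =
  subst (_∈F 𝓑) (sym (p⊆q∧∣q∣≤∣p∣⇒p≡q A⊆B (≤-reflexive (trans (rank _ B∈𝓑) (sym ∣A∣≡k))))) B∈𝓑

IsPaving-dual⇒⊇basis : ∀ {n} {𝓑 : Family n} {k U} → IsPaving (dualBases 𝓑) (n ∸ k) →
  ∣ U ∣ ≡ suc k → ∃[ B ] (B ∈F 𝓑 × B ⊆ U)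
IsPaving-dual⇒⊇basis {n} {𝓑} {k} {U} dual-paving ∣U∣≡1+k =
  let B′ , B′∈𝓑* , ∁U⊆B′ = IsPaving⇒Independent {𝓑 = dualBases 𝓑} dual-paving ∣∁U∣<n∸k
  in  ∁ B′ , B′∈𝓑* , λ x∈∁B′ → x∉∁p⇒x∈p (x∈∁p⇒x∉p x∈∁B′ ∘ ∁U⊆B′)
  where
  ∣∁U∣<n∸k : ∣ ∁ U ∣ < n ∸ k
  ∣∁U∣<n∸k = subst (_< n ∸ k) (sym (trans (∣∁p∣≡n∸∣p∣ U) (cong (n ∸_) ∣U∣≡1+k)))
               (∸-monoʳ-< (n<1+n k) (subst (_≤ n) ∣U∣≡1+k (∣p∣≤n U)))

exchange⇒extension : ∀ {𝓑 : Family n} {k S B₁ B₂ x} → IsMatroidBases 𝓑 → HasRank 𝓑 k →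
  suc ∣ S ∣ ≡ k → S ⊆ B₁ → B₁ ∈F 𝓑 → x ∈ B₁ → x ∉ S → B₂ ∈F 𝓑 → x ∉ B₂ →
  ∃[ y ] (y ∈ B₂ × y ∉ S × (S ∪ ⁅ y ⁆) ∈F 𝓑)
exchange⇒extension {S = S} {B₁} {B₂} {x} (_ , exchange) rank 1+∣S∣≡k S⊆B₁ B₁∈𝓑 x∈B₁ x∉S B₂∈𝓑 x∉B₂ =
  let y , y∈B₂ , y∉B₁ , B₁-x+y∈𝓑 = exchange B₁ B₂ B₁∈𝓑 B₂∈𝓑 x x∈B₁ x∉B₂
      y∉S = y∉B₁ ∘ S⊆B₁
      S⊆B₁-x : S ⊆ B₁ - x
      S⊆B₁-x z∈S = x∈p∧x≢y⇒x∈p-y (S⊆B₁ z∈S) (λ { refl → x∉S z∈S })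
  in  y , y∈B₂ , y∉S ,
      HasRank⇒⊆-basis rank B₁-x+y∈𝓑 (∪-lub (⊆-trans S⊆B₁-x (p⊆p∪q _)) (q⊆p∪q _ _))
        (trans (x∉p⇒∣p∪⁅x⁆∣≡1+∣p∣ y∉S) 1+∣S∣≡k)

sparsePaving-extension : ∀ {n} {𝓑 : Family n} {k S a b} → IsSparsePavingBases n 𝓑 k →
  suc ∣ S ∣ ≡ k → a ∉ S → b ∉ S → a ≢ b → (S ∪ ⁅ a ⁆) ∈F 𝓑 ⊎ (S ∪ ⁅ b ⁆) ∈F 𝓑
sparsePaving-extension {𝓑 = 𝓑} {k} {S} {a} {b} (matroid , rank , paving , dual-paving) 1+∣S∣≡k a∉S b∉S a≢b =
  extend (IsPaving⇒Independent paving ∣S∣<k) (IsPaving-dual⇒⊇basis dual-paving ∣U∣≡1+k)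
  where
  U = (S ∪ ⁅ a ⁆) ∪ ⁅ b ⁆

  ∣S∣<k : ∣ S ∣ < k
  ∣S∣<k = ≤-reflexive 1+∣S∣≡k

  ∣U∣≡1+k : ∣ U ∣ ≡ suc k
  ∣U∣≡1+k = trans (x∉p⇒∣p∪⁅x⁆∣≡1+∣p∣ b∉S∪⁅a⁆) (cong suc (trans (x∉p⇒∣p∪⁅x⁆∣≡1+∣p∣ a∉S) 1+∣S∣≡k))
    where
    b∉S∪⁅a⁆ : b ∉ S ∪ ⁅ a ⁆
    b∉S∪⁅a⁆ b∈S∪⁅a⁆ = [ b∉S , a≢b ∘ sym ]′ (x∈p∪⁅y⁆⁻ b∈S∪⁅a⁆)

  U-extension : ∀ {y} → y ∈ U → y ∉ S → (S ∪ ⁅ y ⁆) ∈F 𝓑 → (S ∪ ⁅ a ⁆) ∈F 𝓑 ⊎ (S ∪ ⁅ b ⁆) ∈F 𝓑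
  U-extension y∈U y∉S S+y∈𝓑 with x∈p∪⁅y⁆⁻ y∈U
  ... | inj₂ refl = inj₂ S+y∈𝓑
  ... | inj₁ y∈S∪⁅a⁆ with x∈p∪⁅y⁆⁻ y∈S∪⁅a⁆
  ...   | inj₁ y∈S = ⊥-elim (y∉S y∈S)
  ...   | inj₂ refl = inj₁ S+y∈𝓑

  extend : Independent 𝓑 S → ∃[ B₂ ] (B₂ ∈F 𝓑 × B₂ ⊆ U) → (S ∪ ⁅ a ⁆) ∈F 𝓑 ⊎ (S ∪ ⁅ b ⁆) ∈F 𝓑
  extend (B₁ , B₁∈𝓑 , S⊆B₁) (B₂ , B₂∈𝓑 , B₂⊆U)
    with ∣q∣<∣p∣⇒∃x∈p∖q (subst (∣ S ∣ <_) (sym (rank B₁ B₁∈𝓑)) ∣S∣<k)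
  ... | x , x∈B₁ , x∉S with x ∈? B₂
  ...   | yes x∈B₂ = U-extension (B₂⊆U x∈B₂) x∉S
                       (HasRank⇒⊆-basis rank B₁∈𝓑 (∪-lub S⊆B₁ (x∈p⇒⁅x⁆⊆p x∈B₁))
                          (trans (x∉p⇒∣p∪⁅x⁆∣≡1+∣p∣ x∉S) 1+∣S∣≡k))
  ...   | no x∉B₂ =
    let y , y∈B₂ , y∉S , S+y∈𝓑 = exchange⇒extension matroid rank 1+∣S∣≡k S⊆B₁ B₁∈𝓑 x∈B₁ x∉S B₂∈𝓑 x∉B₂
    in  U-extension (B₂⊆U y∈B₂) y∉S S+y∈𝓑

∣p∣-even⇒∣p△⁅x⁆∣-odd : ∀ (p : Subset n) x → ∃[ r ] ∣ p ∣ ≡ 2 * r → ∃[ s ] ∣ p △ ⁅ x ⁆ ∣ ≡ suc (2 * s)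
∣p∣-even⇒∣p△⁅x⁆∣-odd p x (r , ∣p∣≡2r) with x ∈? p
... | no x∉p =
  r , trans (cong ∣_∣ (x∉p⇒p△⁅x⁆≡p∪⁅x⁆ x∉p)) (trans (x∉p⇒∣p∪⁅x⁆∣≡1+∣p∣ x∉p) (cong suc ∣p∣≡2r))
... | yes x∈p with r | trans (x∈p⇒1+∣p-x∣≡∣p∣ x∈p) ∣p∣≡2r
...   | suc s | 1+∣p-x∣≡2[1+s] =
  s , trans (cong ∣_∣ (x∈p⇒p△⁅x⁆≡p-x x∈p)) (suc-injective (trans 1+∣p-x∣≡2[1+s] (*-suc 2 s)))

2*r≤n⇒r≤n/2 : ∀ r → 2 * r ≤ n → r ≤ n / 2
2*r≤n⇒r≤n/2 {n} r 2r≤n = subst (_≤ n / 2) (m*n/n≡m r 2) (/-monoˡ-≤ 2 (subst (_≤ n) (*-comm 2 r) 2r≤n))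

layer⊆ : ∀ (𝓕 : Family n) {m} X → X ∈F layer 𝓕 m → X ∈F 𝓕
layer⊆ 𝓕 X X∈layer with 𝓕 X | X∈layer
... | true | _ = refl

module _ {n} {𝓕 : Family n}
  (even : ∀ X → X ∈F 𝓕 → ∃[ r ] ∣ X ∣ ≡ 2 * r)
  (sparse-layers : ∀ r → r ≤ n / 2 → IsSparsePavingBases n (layer 𝓕 (2 * r)) (2 * r)) where

  layer-extension : ∀ {r S a b} → suc ∣ S ∣ ≡ 2 * r → a ∉ S → b ∉ S → a ≢ b →
    (S ∪ ⁅ a ⁆) ∈F 𝓕 ⊎ (S ∪ ⁅ b ⁆) ∈F 𝓕
  layer-extension {r} {S} {a} 1+∣S∣≡2r a∉S b∉S a≢b =
    Sum.map (layer⊆ 𝓕 _) (layer⊆ 𝓕 _) (sparsePaving-extension (sparse-layers r r≤n/2) 1+∣S∣≡2r a∉S b∉S a≢b)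
    where
    r≤n/2 : r ≤ n / 2
    r≤n/2 = 2*r≤n⇒r≤n/2 r (subst (_≤ n) (trans (x∉p⇒∣p∪⁅x⁆∣≡1+∣p∣ a∉S) 1+∣S∣≡2r) (∣p∣≤n (S ∪ ⁅ a ⁆)))

  augment : ∀ {r Z Y} → suc ∣ Z ∣ ≡ 2 * r → ∣ Z ∣ < ∣ Y ∣ → Y ∈F 𝓕 →
    ∃[ f ] (f ∈ Y × f ∉ Z × (Z ∪ ⁅ f ⁆) ∈F 𝓕)
  augment {r} {Z} {Y} 1+∣Z∣≡2r ∣Z∣<∣Y∣ Y∈𝓕 with ∣q∣<∣p∣⇒∃x∈p∖q ∣Z∣<∣Y∣
  ... | f₁ , f₁∈Y , f₁∉Z with Y ⊆? Z ∪ ⁅ f₁ ⁆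
  ...   | yes Y⊆Z+f₁ = f₁ , f₁∈Y , f₁∉Z ,
    subst (_∈F 𝓕) (p⊆q∧∣q∣≤∣p∣⇒p≡q Y⊆Z+f₁ (subst (_≤ ∣ Y ∣) (sym (x∉p⇒∣p∪⁅x⁆∣≡1+∣p∣ f₁∉Z)) ∣Z∣<∣Y∣)) Y∈𝓕
  ...   | no Y⊈Z+f₁ with p⊈q⇒∃x∈p∖q Y⊈Z+f₁
  ...     | f₂ , f₂∈Y , f₂∉Z+f₁ with x∉p∪⁅y⁆⁻ f₂∉Z+f₁
  ...       | f₂∉Z , f₂≢f₁ with layer-extension {r} 1+∣Z∣≡2r f₁∉Z f₂∉Z (f₂≢f₁ ∘ sym)
  ...         | inj₁ Z+f₁∈𝓕 = f₁ , f₁∈Y , f₁∉Z , Z+f₁∈𝓕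
  ...         | inj₂ Z+f₂∈𝓕 = f₂ , f₂∈Y , f₂∉Z , Z+f₂∈𝓕

  reduce : ∀ {r T Y} → ∣ T ∣ ≡ suc (2 * r) → ∣ Y ∣ < ∣ T ∣ → Y ∈F 𝓕 →
    ∃[ f ] (f ∈ T × f ∉ Y × (T - f) ∈F 𝓕)
  reduce {r} {T} {Y} ∣T∣≡1+2r ∣Y∣<∣T∣ Y∈𝓕 with ∣q∣<∣p∣⇒∃x∈p∖q ∣Y∣<∣T∣
  ... | f₁ , f₁∈T , f₁∉Y with T - f₁ ⊆? Y
  ...   | yes T-f₁⊆Y = f₁ , f₁∈T , f₁∉Y ,
    subst (_∈F 𝓕) (sym (p⊆q∧∣q∣≤∣p∣⇒p≡q T-f₁⊆Y
      (≤-pred (subst (∣ Y ∣ <_) (sym (x∈p⇒1+∣p-x∣≡∣p∣ f₁∈T)) ∣Y∣<∣T∣)))) Y∈𝓕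
  ...   | no T-f₁⊈Y with p⊈q⇒∃x∈p∖q T-f₁⊈Y
  ...     | f₂ , f₂∈T-f₁ , f₂∉Y with layer-extension {r} 1+∣S∣≡2r f₁∉S f₂∉S (x∈p-y⇒x≢y f₂∈T-f₁ ∘ sym)
    where
    S = T - f₁ - f₂
    1+∣S∣≡2r : suc ∣ S ∣ ≡ 2 * r
    1+∣S∣≡2r = suc-injective
      (trans (cong suc (x∈p⇒1+∣p-x∣≡∣p∣ f₂∈T-f₁)) (trans (x∈p⇒1+∣p-x∣≡∣p∣ f₁∈T) ∣T∣≡1+2r))
    f₁∉S : f₁ ∉ S
    f₁∉S f₁∈S = x∈p-y⇒x≢y (p─q⊆p _ _ f₁∈S) refl
    f₂∉S : f₂ ∉ S
    f₂∉S f₂∈S = x∈p-y⇒x≢y f₂∈S refl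
  ...       | inj₁ S+f₁∈𝓕 = f₂ , p─q⊆p _ _ f₂∈T-f₁ , f₂∉Y , subst (_∈F 𝓕) S+f₁≡T-f₂ S+f₁∈𝓕
    where
    S+f₁≡T-f₂ : (T - f₁ - f₂) ∪ ⁅ f₁ ⁆ ≡ T - f₂
    S+f₁≡T-f₂ = trans (cong (_∪ ⁅ f₁ ⁆) (p─x─y≡p─y─x T f₁ f₂))
                      (x∈p⇒p-x∪⁅x⁆≡p (x∈p∧x≢y⇒x∈p-y f₁∈T (x∈p-y⇒x≢y f₂∈T-f₁ ∘ sym)))
  ...       | inj₂ S+f₂∈𝓕 = f₁ , f₁∈T , f₁∉Y , subst (_∈F 𝓕) (x∈p⇒p-x∪⁅x⁆≡p f₂∈T-f₁) S+f₂∈𝓕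

  odd-exchange : ∀ Z {Y} → ∃[ r ] ∣ Z ∣ ≡ suc (2 * r) → Y ∈F 𝓕 →
    ∃[ f ] (f ∈ Z △ Y × (Z △ ⁅ f ⁆) ∈F 𝓕)
  odd-exchange Z {Y} (r , ∣Z∣≡1+2r) Y∈𝓕 with <-cmp ∣ Z ∣ ∣ Y ∣
  ... | tri< ∣Z∣<∣Y∣ _ _ =
    let f , f∈Y , f∉Z , Z+f∈𝓕 = augment {suc r} (trans (cong suc ∣Z∣≡1+2r) (sym (*-suc 2 r))) ∣Z∣<∣Y∣ Y∈𝓕
    in  f , x∈q∖p⇒x∈p△q f∈Y f∉Z , subst (_∈F 𝓕) (sym (x∉p⇒p△⁅x⁆≡p∪⁅x⁆ f∉Z)) Z+f∈𝓕
  ... | tri≈ _ ∣Z∣≡∣Y∣ _ =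
    let s , ∣Y∣≡2s = even Y Y∈𝓕
    in  ⊥-elim (even≢odd s r (trans (sym ∣Y∣≡2s) (trans (sym ∣Z∣≡∣Y∣) ∣Z∣≡1+2r)))
  ... | tri> _ _ ∣Y∣<∣Z∣ =
    let f , f∈Z , f∉Y , Z-f∈𝓕 = reduce {r} ∣Z∣≡1+2r ∣Y∣<∣Z∣ Y∈𝓕
    in  f , x∈p∖q⇒x∈p△q f∈Z f∉Y , subst (_∈F 𝓕) (sym (x∈p⇒p△⁅x⁆≡p-x f∈Z)) Z-f∈𝓕

lemma14 : (n : ℕ) → 1 ≤ n → (𝓕 : Family n) →
    (∀ X → X ∈F 𝓕 → ∃[ r ] ∣ X ∣ ≡ 2 * r) →
    (∀ r → r ≤ n / 2 → IsSparsePavingBases n (layer 𝓕 (2 * r)) (2 * r)) →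
    IsDeltaMatroid 𝓕
lemma14 n _ 𝓕 even sparse-layers = nonempty , exchange
  where
  nonempty : ∃[ X ] X ∈F 𝓕
  nonempty = let B , B∈layer₀ = proj₁ (proj₁ (sparse-layers 0 z≤n)) in B , layer⊆ 𝓕 B B∈layer₀

  exchange : ∀ X Y → X ∈F 𝓕 → Y ∈F 𝓕 → ∀ e → e ∈ X △ Y →
    ∃[ f ] (f ∈ X △ Y × (X △ (⁅ e ⁆ ∪ ⁅ f ⁆)) ∈F 𝓕)
  exchange X Y X∈𝓕 Y∈𝓕 e e∈X△Y =
    let f , f∈[X△e]△Y , [X△e]△f∈𝓕 =
          odd-exchange even sparse-layers (X △ ⁅ e ⁆) (∣p∣-even⇒∣p△⁅x⁆∣-odd X e (even X X∈𝓕)) Y∈𝓕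
        f∈X△Y-e = subst (f ∈_) (x∈p△q⇒[p△⁅x⁆]△q≡[p△q]-x X Y e∈X△Y) f∈[X△e]△Y
    in  f , p─q⊆p _ _ f∈X△Y-e ,
        subst (_∈F 𝓕) (x≢y⇒[p△⁅x⁆]△⁅y⁆≡p△[⁅x⁆∪⁅y⁆] X (x∈p-y⇒x≢y f∈X△Y-e ∘ sym)) [X△e]△f∈𝓕
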